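{- If $G$ is a connected bridgeless graph of order $n\ge 1$, then $\mathrm{ola}^+(G)\ge (n-1)/2$.
   Context: Graphs are finite, without loops or parallel edges. A bridge is an edge whose removal increases the number of components. A linear arrangement of $G=(V,E)$ is a bijection $\alpha:V\to\{1,\dots,|V|\}$; net cost $\sum_{uv\in E}(|\alpha(u)-\alpha(v)|-1)$; $\mathrm{ola}^+(G)$ is the minimum net cost. -}

module Defs where

open import Data.Nat using (ℕ; zero; suc; _+_; _∸_; _<_; _*_; ∣_-_∣)
open import Data.Bool using (Bool; true; false; _∧_; _∨_; not; T)
open import Data.Fin using (Fin; toℕ; _<?_)
import Data.Fin as F
open import Data.Fin.Permutation using (Permutation′; _⟨$⟩ʳ_)
open import Data.List using (List; []; _∷_; map; filter; length; allFin)
open import Data.Bool.ListAction using (any)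
open import Data.Nat.ListAction using (sum)
open import Data.Bool.Properties using (T?)
open import Relation.Nullary using (does)
open import Relation.Binary.PropositionalEquality using (_≡_)

record Graph (n : ℕ) : Set where
  field
    adj   : Fin n → Fin n → Bool
    sym   : ∀ u v → adj u v ≡ adj v u
    irrefl : ∀ v → adj v v ≡ false
open Graph public

reachWithin : ∀ {n} → (Fin n → Fin n → Bool) → ℕ → Fin n → Fin n → Bool
reachWithin a zero    u v = does (u F.≟ v)
reachWithin a (suc k) u v =
  reachWithin a k u v ∨ any (λ w → reachWithin a k u w ∧ a w v) (allFin _)

-- u and v lie in the same component: joined by a walk.  On n vertices a walk
-- exists iff one of length ≤ n exists.
reach : ∀ {n} → (Fin n → Fin n → Bool) → Fin n → Fin n → Bool
reach {n} a u v = reachWithin a n u v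

-- Number of connected components: each component is counted once, via its
-- least vertex (a vertex v no smaller vertex of which is in v's component).
components : ∀ {n} → (Fin n → Fin n → Bool) → ℕ
components {n} a =
  length (filter (λ v → T? (not (any (λ u → does (u <? v) ∧ reach a u v) (allFin n))))
                 (allFin n))

Connected : ∀ {n} → Graph n → Set
Connected G = ∀ u v → T (reach (adj G) u v)

deleteEdge : ∀ {n} → (Fin n → Fin n → Bool) → Fin n → Fin n → (Fin n → Fin n → Bool)
deleteEdge a x y u v =
  a u v ∧ not ((does (u F.≟ x) ∧ does (v F.≟ y)) ∨ (does (u F.≟ y) ∧ does (v F.≟ x)))

IsBridge : ∀ {n} → Graph n → Fin n → Fin n → Set
IsBridge G x y = T (adj G x y) × (components (adj G) < components (deleteEdge (adj G) x y))
  where open import Data.Product using (_×_)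

Bridgeless : ∀ {n} → Graph n → Set
Bridgeless G = ∀ x y → IsBridge G x y → ⊥
  where open import Data.Empty using (⊥)

-- Linear arrangement: a bijection α : V → {1,…,n}, here Fin n ↔ Fin n
-- (positions shifted by one, which does not affect differences).
Arrangement : ℕ → Set
Arrangement n = Permutation′ n

netCost : ∀ {n} → Graph n → Arrangement n → ℕ
netCost {n} G α =
  sum (map (λ u → sum (map (λ v → term u v) (allFin n))) (allFin n))
  where
    term : Fin n → Fin n → ℕ
    term u v with does (u <? v) ∧ adj G u v
    ... | true  = ∣ toℕ (α ⟨$⟩ʳ u) - toℕ (α ⟨$⟩ʳ v) ∣ ∸ 1
    ... | false = 0

-- Cut the arrangement between positions i and i + 1, for each of the n − 1
-- gaps, and let xy be the pair of vertices placed there.  By connectivity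
-- some edge crosses the cut, and it cannot be xy alone, for then xy would
-- be a bridge; every crossing edge other than xy has length at least 2.
-- An edge of length d ≥ 2 crosses at most d ≤ 2 (d − 1) gaps, so summing
-- over the gaps gives n − 1 ≤ 2 · ola⁺.
module Submission where

open import Defs hiding (sym)
open import Data.Nat using (ℕ; suc; _≤_; _*_; _∸_; _≥_)

open import Data.Bool using (Bool; true; false; not; _∧_; _∨_; _xor_; T)
import Data.Bool.Properties as Bool
open import Data.Bool.Properties using (T-∧; T-∨; T?)
open import Data.Bool.ListAction using (any)
open import Data.Empty using (⊥-elim)
open import Data.Fin using (Fin; zero; suc; toℕ; inject₁; _<?_; _≟_) renaming (_<_ to _<ᶠ_)
open import Data.Fin.Induction using (<-wellFounded)
open import Data.Fin.Permutation using (_⟨$⟩ʳ_; _⟨$⟩ˡ_; inverseˡ; inverseʳ)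
open import Data.Fin.Properties using (any?; <-cmp; toℕ-injective; toℕ-inject₁)
open import Data.List using (map; filter; length; tabulate; allFin)
open import Data.List.Membership.Propositional using (lose)
open import Data.List.Membership.Propositional.Properties using (∈-allFin; ∈-tabulate⁺; ∈-filter⁺; ∈-length)
open import Data.List.Properties using (map-tabulate; filter-accept; filter-none)
open import Data.List.Relation.Unary.All.Properties using (tabulate⁺)
open import Data.List.Relation.Unary.Any using (satisfied)
open import Data.List.Relation.Unary.Any.Properties using (any⁺; any⁻)
open import Data.Nat using (zero; _+_; _<_; z≤n; s≤s; ∣_-_∣; _<ᵇ_; _≤ᵇ_)
open import Data.Nat.ListAction using (sum)
open import Data.Nat.Properties using (+-*-semiring; ≤-refl; ≤-trans; ≤-reflexive; m≤m+n; m≤n+m; +-mono-≤; +-suc; n≮0; ≰⇒>; ≤⇒≤ᵇ; ≤ᵇ⇒≤; ∣-∣-comm; ∣-∣-identityʳ; module ≤-Reasoning)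
open import Data.Product using (_×_; _,_; Σ-syntax; ∃-syntax; ∃₂; proj₁; proj₂)
import Data.Product as Product
open import Data.Product.Function.NonDependent.Propositional using (_×-⇔_)
open import Data.Sum using (_⊎_; inj₁; inj₂)
import Data.Sum as Sum
open import Data.Sum.Function.Propositional using (_⊎-⇔_)
open import Function using (_∘_; _⇔_; mk⇔; Equivalence)
import Function.Properties.Equivalence as ⇔
open import Induction.WellFounded using (Acc; acc)
open import Level using (0ℓ)
open import Relation.Binary using (Rel; _=[_]⇒_; tri<; tri≈; tri>)
open import Relation.Binary.PropositionalEquality using (_≡_; _≢_; refl; sym; trans; cong; cong₂; subst; subst₂; module ≡-Reasoning)
open import Relation.Nullary using (¬_; Dec; yes; no; does; ¬?; contradiction)
open import Relation.Nullary.Decidable using (decidable-stable; _×-dec_)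

open import Algebra.Properties.Semiring.Sum +-*-semiring
  using (sum-syntax; sum-cong-≗; sum-replicate-zero; ∑-comm; *-distribˡ-sum)

open Equivalence using (to; from)

private
  variable
    n m : ℕ
    A : Set

T-does : (a? : Dec A) → T (does a?) ⇔ A
T-does (yes a) = mk⇔ (λ _ → a) (λ _ → _)
T-does (no ¬a) = mk⇔ (λ ()) ¬a

T-not : ∀ {b} → T (not b) ⇔ (¬ T b)
T-not {false} = mk⇔ (λ _ ()) (λ _ → _)
T-not {true}  = mk⇔ (λ ()) (λ ¬t → ¬t _)

T-stable : ∀ {b} → ¬ ¬ T b → T b
T-stable {b} = decidable-stable (T? b)

≢-either : ∀ {x y : Bool} → x ≢ y → (z : Bool) → x ≢ z ⊎ y ≢ z
≢-either {x} x≢y z with x Bool.≟ z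
... | yes refl = inj₂ (x≢y ∘ sym)
... | no  x≢z  = inj₁ x≢z

≢⇒T-xor : ∀ {x y} → x ≢ y → T (x xor y)
≢⇒T-xor {false} {false} x≢y = x≢y refl
≢⇒T-xor {false} {true}  _   = _
≢⇒T-xor {true}  {false} _   = _
≢⇒T-xor {true}  {true}  x≢y = x≢y refl

∑-mono-≤ : {f g : Fin n → ℕ} → (∀ i → f i ≤ g i) → ∑[ i < n ] f i ≤ ∑[ i < n ] g i
∑-mono-≤ {zero}  f≤g = z≤n
∑-mono-≤ {suc n} f≤g = +-mono-≤ (f≤g zero) (∑-mono-≤ (f≤g ∘ suc))

term≤∑ : (f : Fin n → ℕ) (i : Fin n) → f i ≤ ∑[ j < n ] f j
term≤∑ f zero    = m≤m+n (f zero) _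
term≤∑ f (suc i) = ≤-trans (term≤∑ (f ∘ suc) i) (m≤n+m _ (f zero))

n≤∑ : {f : Fin n → ℕ} → (∀ i → 1 ≤ f i) → n ≤ ∑[ i < n ] f i
n≤∑ {zero}  _   = z≤n
n≤∑ {suc n} 1≤f = +-mono-≤ (1≤f zero) (n≤∑ (1≤f ∘ suc))

∑0≤ : ∀ m {c} → ∑[ i < m ] 0 ≤ c
∑0≤ m = ≤-trans (≤-reflexive (sum-replicate-zero m)) z≤n

sum-tabulate : (f : Fin n → ℕ) → sum (tabulate f) ≡ ∑[ i < n ] f i
sum-tabulate {zero}  f = refl
sum-tabulate {suc n} f = cong (f zero +_) (sum-tabulate (f ∘ suc))

sum-map-allFin : (f : Fin n → ℕ) → sum (map f (allFin n)) ≡ ∑[ i < n ] f i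
sum-map-allFin f = trans (cong sum (map-tabulate (λ i → i) f)) (sum-tabulate f)

∑-comm-inward : ∀ {k} (f : Fin m → Fin n → Fin k → ℕ) →
  ∑[ i < m ] ∑[ u < n ] ∑[ v < k ] f i u v ≡ ∑[ u < n ] ∑[ v < k ] ∑[ i < m ] f i u v
∑-comm-inward {k = k} f = trans (∑-comm (λ i u → ∑[ v < k ] f i u v)) (sum-cong-≗ λ u → ∑-comm (λ i v → f i u v))

*-distribˡ-∑∑ : ∀ {k} c (f : Fin n → Fin k → ℕ) →
  c * ∑[ u < n ] ∑[ v < k ] f u v ≡ ∑[ u < n ] ∑[ v < k ] (c * f u v)
*-distribˡ-∑∑ {k = k} c f = trans (*-distribˡ-sum c (λ u → ∑[ v < k ] f u v)) (sum-cong-≗ λ u → *-distribˡ-sum c (f u))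

indicator : Bool → ℕ
indicator true  = 1
indicator false = 0

T⇒1≤indicator : ∀ {b} → T b → 1 ≤ indicator b
T⇒1≤indicator {true} _ = ≤-refl

-- Counts each unordered pair once, as netCost does.
pairIndicator : (Fin n → Fin n → Bool) → Fin n → Fin n → ℕ
pairIndicator r u v = indicator (does (u <? v) ∧ r u v)

1≤∑∑pairIndicator-< : (r : Fin n → Fin n → Bool) {u v : Fin n} → u <ᶠ v → T (r u v) →
                      1 ≤ ∑[ u < n ] ∑[ v < n ] pairIndicator r u v
1≤∑∑pairIndicator-< {n} r {u} {v} u<v ruv = begin
  1                                          ≤⟨ T⇒1≤indicator (from T-∧ (from (T-does (u <? v)) u<v , ruv)) ⟩
  pairIndicator r u v                        ≤⟨ term≤∑ (pairIndicator r u) v ⟩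
  ∑[ v < n ] pairIndicator r u v             ≤⟨ term≤∑ (λ u → ∑[ v < n ] pairIndicator r u v) u ⟩
  ∑[ u < n ] ∑[ v < n ] pairIndicator r u v  ∎
  where open ≤-Reasoning

1≤∑∑pairIndicator : (r : Fin n → Fin n → Bool) → (∀ {u v} → T (r u v) → T (r v u)) →
                    {p q : Fin n} → p ≢ q → T (r p q) →
                    1 ≤ ∑[ u < n ] ∑[ v < n ] pairIndicator r u v
1≤∑∑pairIndicator r r-sym {p} {q} p≢q rpq with <-cmp p q
... | tri< p<q _ _ = 1≤∑∑pairIndicator-< r p<q rpq
... | tri≈ _ p≡q _ = contradiction p≡q p≢q
... | tri> _ _ q<p = 1≤∑∑pairIndicator-< r q<p (r-sym rpq)

-- Gap i separates the positions ≤ i from those > i.  It is tested as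
-- a <ᵇ suc i rather than a ≤ᵇ i because the former computes when a and
-- i are both successors.
leftOf : ℕ → ℕ → Bool
leftOf i a = a <ᵇ suc i

leftOf-self≢leftOf-suc : ∀ i → leftOf i i ≢ leftOf i (suc i)
leftOf-self≢leftOf-suc zero    ()
leftOf-self≢leftOf-suc (suc i) = leftOf-self≢leftOf-suc i

separates : ℕ → ℕ → ℕ → Bool
separates i a b = leftOf i a xor leftOf i b

∑-separates≤∣-∣ : ∀ m a b → ∑[ i < m ] indicator (separates (toℕ i) a b) ≤ ∣ a - b ∣
∑-separates≤∣-∣ zero    a       b       = z≤n
∑-separates≤∣-∣ (suc m) zero    zero    = ∑-separates≤∣-∣ m zero zero
∑-separates≤∣-∣ (suc m) zero    (suc b) = s≤s (∑-separates≤∣-∣ m zero b)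
∑-separates≤∣-∣ (suc m) (suc a) zero    =
  s≤s (≤-trans (∑-separates≤∣-∣ m a zero) (≤-reflexive (∣-∣-identityʳ a)))
∑-separates≤∣-∣ (suc m) (suc a) (suc b) = ∑-separates≤∣-∣ m a b

separates-∣-∣≤1 : ∀ i a b → T (separates i a b) → ∣ a - b ∣ ≤ 1 →
                  (a ≡ i × b ≡ suc i) ⊎ (a ≡ suc i × b ≡ i)
separates-∣-∣≤1 zero    zero          (suc zero)    _   _        = inj₁ (refl , refl)
separates-∣-∣≤1 zero    (suc zero)    zero          _   _        = inj₂ (refl , refl)
separates-∣-∣≤1 (suc i) (suc a)       (suc b)       sep short    =
  Sum.map (Product.map (cong suc) (cong suc)) (Product.map (cong suc) (cong suc))
          (separates-∣-∣≤1 i a b sep short)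
separates-∣-∣≤1 _       zero          (suc (suc _)) _   (s≤s ())
separates-∣-∣≤1 _       (suc (suc _)) zero          _   (s≤s ())
separates-∣-∣≤1 _       zero          zero          ()  _
separates-∣-∣≤1 zero    (suc _)       (suc _)       ()  _
separates-∣-∣≤1 (suc _) zero          (suc zero)    ()  _
separates-∣-∣≤1 (suc _) (suc zero)    zero          ()  _

Adj : (Fin n → Fin n → Bool) → Rel (Fin n) 0ℓ
Adj a p q = T (a p q)

reachWithin-respects : {f : Fin n → A} (a : Fin n → Fin n → Bool) (k : ℕ) →
                       Adj a =[ f ]⇒ _≡_ → Adj (reachWithin a k) =[ f ]⇒ _≡_
reachWithin-respects {f = f} a zero    _    {u} {v} u≡v = cong f (to (T-does (u ≟ v)) u≡v)
reachWithin-respects         a (suc k) resp {u} {v} r with to T-∨ r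
... | inj₁ r′ = reachWithin-respects a k resp r′
... | inj₂ r′
  with _ , uw∧wv ← satisfied (any⁻ (λ w → reachWithin a k u w ∧ a w v) (allFin _) r′)
  with uw , wv ← to T-∧ uw∧wv
  = trans (reachWithin-respects a k resp uw) (resp wv)

CrossingEdge : (Fin n → Fin n → Bool) → (Fin n → Bool) → Set
CrossingEdge a S = ∃₂ λ p q → Adj a p q × S p ≢ S q

crossingEdge? : (a : Fin n → Fin n → Bool) (S : Fin n → Bool) →
                CrossingEdge a S ⊎ Adj a =[ S ]⇒ _≡_
crossingEdge? a S with any? (λ p → any? (λ q → T? (a p q) ×-dec ¬? (S p Bool.≟ S q)))
... | yes (p , q , e , Sp≢Sq) = inj₁ (p , q , e , Sp≢Sq)
... | no none = inj₂ λ {p} {q} e → decidable-stable (S p Bool.≟ S q) λ Sp≢Sq → none (p , q , e , Sp≢Sq)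

connected⇒crossingEdge : (G : Graph n) {S : Fin n → Bool} {u v : Fin n} →
                         Connected G → S u ≢ S v → CrossingEdge (adj G) S
connected⇒crossingEdge {n} G {S} {u} {v} conn Su≢Sv with crossingEdge? (adj G) S
... | inj₁ crossing = crossing
... | inj₂ resp     = contradiction (reachWithin-respects (adj G) n resp (conn u v)) Su≢Sv

-- components counts the roots, the vertices reached from no smaller vertex.
reachedFromBelow : (Fin n → Fin n → Bool) → Fin n → Bool
reachedFromBelow {n} a v = any (λ u → does (u <? v) ∧ reach a u v) (allFin n)

isRoot : (Fin n → Fin n → Bool) → Fin n → Bool
isRoot a v = not (reachedFromBelow a v)

T-reachedFromBelow : {a : Fin n → Fin n → Bool} {v : Fin n} →
                     T (reachedFromBelow a v) ⇔ (∃[ u ] u <ᶠ v × T (reach a u v))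
T-reachedFromBelow {a = a} {v} = mk⇔
  (λ found → let u , u<v∧r = satisfied (any⁻ (λ u → does (u <? v) ∧ reach a u v) (allFin _) found)
                 u<v , r   = to T-∧ u<v∧r
             in u , to (T-does (u <? v)) u<v , r)
  (λ (u , u<v , r) → any⁺ _ (lose (∈-allFin u) (from T-∧ (from (T-does (u <? v)) u<v , r))))

reachedFromBelow⇒¬isRoot : {a : Fin n → Fin n → Bool} {u v : Fin n} →
                           u <ᶠ v → T (reach a u v) → ¬ T (isRoot a v)
reachedFromBelow⇒¬isRoot {a = a} {v = v} u<v r root =
  to (T-not {reachedFromBelow a v}) root (from T-reachedFromBelow (_ , u<v , r))

¬isRoot⇒reachedFromBelow : {a : Fin n → Fin n → Bool} {v : Fin n} →
                           ¬ T (isRoot a v) → ∃[ u ] u <ᶠ v × T (reach a u v)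
¬isRoot⇒reachedFromBelow {a = a} {v} ¬root =
  to T-reachedFromBelow (T-stable (¬root ∘ from (T-not {reachedFromBelow a v})))

zero-isRoot : (a : Fin (suc n) → Fin (suc n) → Bool) → T (isRoot a zero)
zero-isRoot a = from (T-not {reachedFromBelow a zero}) λ found →
  n≮0 (proj₁ (proj₂ (to (T-reachedFromBelow {a = a}) found)))

components-suc : (a : Fin (suc n) → Fin (suc n) → Bool) →
                 components a ≡ suc (length (filter (λ v → T? (isRoot a v)) (tabulate suc)))
components-suc a =
  cong length (filter-accept (λ v → T? (isRoot a v)) {x = zero} {xs = tabulate suc} (zero-isRoot a))

connected⇒components≤1 : (G : Graph n) → Connected G → components (adj G) ≤ 1
connected⇒components≤1 {zero}  G conn = z≤n
connected⇒components≤1 {suc n} G conn = ≤-reflexive (trans (components-suc (adj G))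
  (cong (suc ∘ length) (filter-none (λ v → T? (isRoot (adj G) v)) (tabulate⁺ λ j →
    reachedFromBelow⇒¬isRoot {a = adj G} (s≤s z≤n) (conn zero (suc j))))))

rootOnSameSide : {a : Fin n → Fin n → Bool} {S : Fin n → A} →
                 Adj a =[ S ]⇒ _≡_ → (v : Fin n) → ∃[ w ] T (isRoot a w) × S w ≡ S v
rootOnSameSide {n} {a = a} {S} resp v = descend v (<-wellFounded v)
  where
  descend : (v : Fin n) → Acc _<ᶠ_ v → ∃[ w ] T (isRoot a w) × S w ≡ S v
  descend v (acc below) with T? (isRoot a v)
  ... | yes root = v , root , refl
  ... | no ¬root =
    let u , u<v , r      = ¬isRoot⇒reachedFromBelow ¬root
        w , root , Sw≡Su = descend u (below u<v)
    in w , root , trans Sw≡Su (reachWithin-respects a n resp r)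

cut⇒2≤components : {a : Fin n → Fin n → Bool} {S : Fin n → Bool} {u v : Fin n} →
                   Adj a =[ S ]⇒ _≡_ → S u ≢ S v → 2 ≤ components a
cut⇒2≤components {zero} {u = ()}
cut⇒2≤components {suc n} {a} {S} {u} {v} resp Su≢Sv
  with t , St≢S0 ← Sum.[ (u ,_) , (v ,_) ]′ (≢-either Su≢Sv (S zero))
  with rootOnSameSide resp t
... | zero  , _    , S0≡St = contradiction (sym S0≡St) St≢S0
... | suc w , root , _     = ≤-trans
  (s≤s (∈-length (∈-filter⁺ (λ v → T? (isRoot a v)) (∈-tabulate⁺ w) root)))
  (≤-reflexive (sym (components-suc a)))

SameEnds : (x y p q : Fin n) → Set
SameEnds x y p q = (p ≡ x × q ≡ y) ⊎ (p ≡ y × q ≡ x)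

T-endsMatch : {x y p q : Fin n} →
              T ((does (p ≟ x) ∧ does (q ≟ y)) ∨ (does (p ≟ y) ∧ does (q ≟ x))) ⇔ SameEnds x y p q
T-endsMatch {x = x} {y} {p} {q} = ⇔.trans T-∨
  (⇔.trans T-∧ (T-does (p ≟ x) ×-⇔ T-does (q ≟ y)) ⊎-⇔ ⇔.trans T-∧ (T-does (p ≟ y) ×-⇔ T-does (q ≟ x)))

deleteEdge⇒edge : {a : Fin n → Fin n → Bool} {x y p q : Fin n} →
                  T (deleteEdge a x y p q) → T (a p q) × ¬ SameEnds x y p q
deleteEdge⇒edge e with apq , unmatched ← to T-∧ e = apq , to T-not unmatched ∘ from T-endsMatch

¬deleteEdge⇒SameEnds : {a : Fin n → Fin n → Bool} {x y p q : Fin n} →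
                       T (a p q) → ¬ T (deleteEdge a x y p q) → SameEnds x y p q
¬deleteEdge⇒SameEnds apq ¬e = to T-endsMatch (T-stable λ unmatched → ¬e (from T-∧ (apq , from T-not unmatched)))

-- If xy were the only edge across the cut, deleting it would disconnect the graph.
bridgeless⇒otherCrossingEdge : (G : Graph n) {S : Fin n → Bool} {x y : Fin n} →
                               Connected G → Bridgeless G → S x ≢ S y →
                               ∃₂ λ p q → T (adj G p q) × S p ≢ S q × ¬ SameEnds x y p q
bridgeless⇒otherCrossingEdge G {S} {x} {y} conn bridgeless Sx≢Sy
  with crossingEdge? (deleteEdge (adj G) x y) S
... | inj₁ (p , q , e , Sp≢Sq) =
  let apq , notxy = deleteEdge⇒edge {a = adj G} e in p , q , apq , Sp≢Sq , notxy
... | inj₂ resp = ⊥-elim (bridgeless x y (xy , components-grow))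
  where
  components-grow : components (adj G) < components (deleteEdge (adj G) x y)
  components-grow = ≤-trans (s≤s (connected⇒components≤1 G conn))
                            (cut⇒2≤components {a = deleteEdge (adj G) x y} resp Sx≢Sy)
  xy : T (adj G x y)
  xy with p , q , apq , Sp≢Sq ← connected⇒crossingEdge G conn Sx≢Sy
     with ¬deleteEdge⇒SameEnds {a = adj G} {x} {y} {p} {q} apq (Sp≢Sq ∘ resp)
  ... | inj₁ (refl , refl) = apq
  ... | inj₂ (refl , refl) = subst T (Graph.sym G y x) apq

position : Arrangement n → Fin n → ℕ
position α v = toℕ (α ⟨$⟩ʳ v)

stretch : Arrangement n → Fin n → Fin n → ℕ
stretch α u v = ∣ position α u - position α v ∣

position-⟨$⟩ˡ : (α : Arrangement n) (k : Fin n) → position α (α ⟨$⟩ˡ k) ≡ toℕ k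
position-⟨$⟩ˡ α k = cong toℕ (inverseʳ α)

position-injective : (α : Arrangement n) {u v : Fin n} → position α u ≡ position α v → u ≡ v
position-injective α {u} {v} eq = begin
  u                       ≡⟨ inverseˡ α ⟨
  α ⟨$⟩ˡ (α ⟨$⟩ʳ u)       ≡⟨ cong (α ⟨$⟩ˡ_) (toℕ-injective eq) ⟩
  α ⟨$⟩ˡ (α ⟨$⟩ʳ v)       ≡⟨ inverseˡ α ⟩
  v                       ∎
  where open ≡-Reasoning

-- The summand of netCost is local to its where-block; unification recovers it.
netCost-summand : (G : Graph n) (α : Arrangement n) →
  Σ[ c ∈ (Fin n → Fin n → ℕ) ] netCost G α ≡ sum (map (λ u → sum (map (c u) (allFin n))) (allFin n))
netCost-summand G α = _ , refl

edgeNetCost : Graph n → Arrangement n → Fin n → Fin n → ℕ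
edgeNetCost G α = proj₁ (netCost-summand G α)

netCost≡∑∑edgeNetCost : (G : Graph n) (α : Arrangement n) →
                        netCost G α ≡ ∑[ u < n ] ∑[ v < n ] edgeNetCost G α u v
netCost≡∑∑edgeNetCost {n} G α = begin
  netCost G α                                ≡⟨ proj₂ (netCost-summand G α) ⟩
  sum (map rowSum (allFin n))                ≡⟨ sum-map-allFin rowSum ⟩
  ∑[ u < n ] rowSum u                        ≡⟨ sum-cong-≗ (sum-map-allFin ∘ edgeNetCost G α) ⟩
  ∑[ u < n ] ∑[ v < n ] edgeNetCost G α u v  ∎
  where
  open ≡-Reasoning
  rowSum : Fin n → ℕ
  rowSum u = sum (map (edgeNetCost G α u) (allFin n))

longCrossing : Graph n → Arrangement n → ℕ → Fin n → Fin n → Bool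
longCrossing G α i u v = adj G u v ∧ (2 ≤ᵇ stretch α u v) ∧ separates i (position α u) (position α v)

longCrossing-sym : (G : Graph n) (α : Arrangement n) (i : ℕ) {u v : Fin n} →
                   T (longCrossing G α i u v) → T (longCrossing G α i v u)
longCrossing-sym G α i {u} {v} = subst T (cong₂ _∧_ (Graph.sym G u v) (cong₂ _∧_
  (cong (2 ≤ᵇ_) (∣-∣-comm (position α u) (position α v)))
  (Bool.xor-comm (leftOf i (position α u)) (leftOf i (position α v)))))

n≤2*[n∸1] : ∀ {d} → 2 ≤ d → d ≤ 2 * (d ∸ 1)
n≤2*[n∸1] {suc (suc k)} _ = s≤s (≤-trans (s≤s (m≤m+n k (k + 0))) (≤-reflexive (sym (+-suc k (k + 0)))))
n≤2*[n∸1] {suc zero} (s≤s ())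

∑-longCrossing≤2*edgeNetCost : (G : Graph n) (α : Arrangement n) (m : ℕ) (u v : Fin n) →
  ∑[ i < m ] pairIndicator (longCrossing G α (toℕ i)) u v ≤ 2 * edgeNetCost G α u v
∑-longCrossing≤2*edgeNetCost G α m u v with does (u <? v) | adj G u v | 2 ≤ᵇ stretch α u v in long
... | false | _     | _     = ∑0≤ m
... | true  | false | _     = ∑0≤ m
... | true  | true  | false = ∑0≤ m
... | true  | true  | true  = ≤-trans (∑-separates≤∣-∣ m (position α u) (position α v))
                                      (n≤2*[n∸1] (≤ᵇ⇒≤ 2 _ (subst T (sym long) _)))

module Gap {m : ℕ} (α : Arrangement (suc m)) (i : Fin m) where

  side : Fin (suc m) → Bool
  side = leftOf (toℕ i) ∘ position α

  lastLeft firstRight : Fin (suc m)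
  lastLeft   = α ⟨$⟩ˡ inject₁ i
  firstRight = α ⟨$⟩ˡ suc i

  position-lastLeft : position α lastLeft ≡ toℕ i
  position-lastLeft = trans (position-⟨$⟩ˡ α (inject₁ i)) (toℕ-inject₁ i)

  position-firstRight : position α firstRight ≡ suc (toℕ i)
  position-firstRight = position-⟨$⟩ˡ α (suc i)

  side-lastLeft≢side-firstRight : side lastLeft ≢ side firstRight
  side-lastLeft≢side-firstRight =
    subst₂ (λ a b → leftOf (toℕ i) a ≢ leftOf (toℕ i) b) (sym position-lastLeft) (sym position-firstRight)
           (leftOf-self≢leftOf-suc (toℕ i))

  short-crossing⇒SameEnds : {p q : Fin (suc m)} → side p ≢ side q → stretch α p q ≤ 1 →
                            SameEnds lastLeft firstRight p q
  short-crossing⇒SameEnds {p} {q} Sp≢Sq short =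
    Sum.map (Product.map atLastLeft atFirstRight) (Product.map atFirstRight atLastLeft)
            (separates-∣-∣≤1 (toℕ i) (position α p) (position α q) (≢⇒T-xor Sp≢Sq) short)
    where
    atLastLeft : ∀ {v} → position α v ≡ toℕ i → v ≡ lastLeft
    atLastLeft eq = position-injective α (trans eq (sym position-lastLeft))
    atFirstRight : ∀ {v} → position α v ≡ suc (toℕ i) → v ≡ firstRight
    atFirstRight eq = position-injective α (trans eq (sym position-firstRight))

  crossed : (G : Graph (suc m)) → Connected G → Bridgeless G →
            1 ≤ ∑[ u < suc m ] ∑[ v < suc m ] pairIndicator (longCrossing G α (toℕ i)) u v
  crossed G conn bridgeless
    with p , q , apq , Sp≢Sq , notLastFirst
           ← bridgeless⇒otherCrossingEdge G conn bridgeless side-lastLeft≢side-firstRight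
    = 1≤∑∑pairIndicator (longCrossing G α (toℕ i)) (longCrossing-sym G α (toℕ i)) (Sp≢Sq ∘ cong side)
        (from T-∧ (apq , from T-∧ (≤⇒≤ᵇ long , ≢⇒T-xor Sp≢Sq)))
    where
    long : 2 ≤ stretch α p q
    long = ≰⇒> (notLastFirst ∘ short-crossing⇒SameEnds Sp≢Sq)

lemma2p4 : ∀ (n : ℕ) → n ≥ 1 → (G : Graph n) → Connected G → Bridgeless G →
    ∀ (α : Arrangement n) → n ∸ 1 ≤ 2 * netCost G α
lemma2p4 (suc m) _ G conn bridgeless α = begin
  m                                                        ≤⟨ n≤∑ (λ i → Gap.crossed α i G conn bridgeless) ⟩
  ∑[ i < m ] ∑[ u < suc m ] ∑[ v < suc m ] crossing i u v  ≡⟨ ∑-comm-inward crossing ⟩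
  ∑[ u < suc m ] ∑[ v < suc m ] ∑[ i < m ] crossing i u v  ≤⟨ ∑-mono-≤ (λ u → ∑-mono-≤ (∑-longCrossing≤2*edgeNetCost G α m u)) ⟩
  ∑[ u < suc m ] ∑[ v < suc m ] (2 * edgeNetCost G α u v)  ≡⟨ *-distribˡ-∑∑ 2 (edgeNetCost G α) ⟨
  2 * ∑[ u < suc m ] ∑[ v < suc m ] edgeNetCost G α u v    ≡⟨ cong (2 *_) (netCost≡∑∑edgeNetCost G α) ⟨
  2 * netCost G α                                          ∎
  where
  open ≤-Reasoning
  crossing : Fin m → Fin (suc m) → Fin (suc m) → ℕ
  crossing i u v = pairIndicator (longCrossing G α (toℕ i)) u v
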